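{- Let $P$ be a finite bounded poset with a left modular maximal chain $\hat0=x_0\lessdot x_1\lessdot\cdots\lessdot x_n=\hat1$, let $l_1<\cdots<l_n$ be integers, and let $\gamma$ be the induced edge-labelling: for $y\lessdot z$, $\gamma(y,z)=l_i$ where $(x_{i-1}\vee y)\wedge_y z=y$ and $(x_i\vee y)\wedge_y z=z$. Then for every $y\lessdot z$ in $P$, $\gamma(y,z)=l_i$ if and only if $$i=\min\{j: x_j\vee y\ge z\}=\max\{j+1: x_j\wedge z\le y\}.$$
   Context: A poset is bounded if it has unique minimum $\hat0$ and maximum $\hat1$. $x\vee y$, $x\wedge y$ denote least common upper bound / greatest common lower bound when they exist. For $w,z\ge y$, $w\wedge_y z$ is the greatest element of $\{u: y\le u\le w,\ u\le z\}$ if it exists; for $w,y\le z$, $w\vee^z y$ is the least element of $\{u: w,y\le u\le z\}$ if it exists. An element $x$ is viable if for all $y\le z$ both $(x\vee y)\wedge_y z$ and $(x\wedge z)\vee^z y$ exist; a viable $x$ is left modular if $(x\vee y)\wedge_y z=(x\wedge z)\vee^z y$ for all $y\le z$. A maximal chain is left modular if all its elements are viable and left modular. -}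

module Defs where

open import Data.Nat using (ℕ; suc; _≤_; _<_)
open import Data.Integer as ℤ using (ℤ)
open import Data.Fin using (Fin)
open import Data.Product using (Σ; _×_; ∃)
open import Data.Sum using (_⊎_)
open import Relation.Nullary using (¬_)
open import Relation.Binary.PropositionalEquality using (_≡_)
open import Relation.Binary.Structures using (IsPartialOrder)
open import Function.Bundles using (_↔_)

module _ {A : Set} (_⊑_ : A → A → Set) where

  Covers : A → A → Set
  Covers y z = (y ⊑ z) × (¬ (y ≡ z)) × (∀ u → y ⊑ u → u ⊑ z → (u ≡ y) ⊎ (u ≡ z))

  IsJoin : A → A → A → Set
  IsJoin a b u = (a ⊑ u) × (b ⊑ u) × (∀ w → a ⊑ w → b ⊑ w → u ⊑ w)

  IsMeet : A → A → A → Set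
  IsMeet a b u = (u ⊑ a) × (u ⊑ b) × (∀ w → w ⊑ a → w ⊑ b → w ⊑ u)

  IsRelMeet : (y w z u : A) → Set
  IsRelMeet y w z u = (y ⊑ u) × (u ⊑ w) × (u ⊑ z)
                    × (∀ v → y ⊑ v → v ⊑ w → v ⊑ z → v ⊑ u)

  IsRelJoin : (z w y u : A) → Set
  IsRelJoin z w y u = (w ⊑ u) × (y ⊑ u) × (u ⊑ z)
                    × (∀ v → w ⊑ v → y ⊑ v → v ⊑ z → u ⊑ v)

  LeftExpr : (x y z u : A) → Set
  LeftExpr x y z u = Σ A λ j → IsJoin x y j × IsRelMeet y j z u

  RightExpr : (x y z u : A) → Set
  RightExpr x y z u = Σ A λ m → IsMeet x z m × IsRelJoin z m y u

  Viable : A → Set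
  Viable x = ∀ y z → y ⊑ z → (∃ λ u → LeftExpr x y z u) × (∃ λ u → RightExpr x y z u)

  LeftModular : A → Set
  LeftModular x = Viable x × (∀ y z u v → y ⊑ z → LeftExpr x y z u → RightExpr x y z v → u ≡ v)

  JoinAbove : A → A → A → Set
  JoinAbove a b c = Σ A λ j → IsJoin a b j × (c ⊑ j)

  MeetBelow : A → A → A → Set
  MeetBelow a b c = Σ A λ m → IsMeet a b m × (m ⊑ c)

  -- x : ℕ → A is a left modular maximal chain ⊥ = x₀ ⋖ x₁ ⋖ ⋯ ⋖ xₙ = ⊤
  -- (only the values x 0, …, x n matter)
  IsLeftModularMaximalChain : (bot top : A) (n : ℕ) (x : ℕ → A) → Set
  IsLeftModularMaximalChain bot top n x =
    (x 0 ≡ bot) × (x n ≡ top)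
    × (∀ i → i < n → Covers (x i) (x (suc i)))
    × (∀ i → i ≤ n → LeftModular (x i))

  -- γ(y,z) = v  for the edge-labelling induced by the chain x and labels l₁,…,lₙ:
  -- v = l i for some 1 ≤ i ≤ n with (x_{i-1} ∨ y) ∧_y z = y and (x_i ∨ y) ∧_y z = z
  Label : (n : ℕ) (x : ℕ → A) (l : ℕ → ℤ) (y z : A) (v : ℤ) → Set
  Label n x l y z v = Σ ℕ λ k → (suc k ≤ n) × (v ≡ l (suc k))
                      × LeftExpr (x k) y z y × LeftExpr (x (suc k)) y z z

  IsMinJoinAbove : (n : ℕ) (x : ℕ → A) (y z : A) (i : ℕ) → Set
  IsMinJoinAbove n x y z i = (i ≤ n) × JoinAbove (x i) y z
                             × (∀ j → j ≤ n → JoinAbove (x j) y z → i ≤ j)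

  IsMaxMeetBelow : (n : ℕ) (x : ℕ → A) (y z : A) (i : ℕ) → Set
  IsMaxMeetBelow n x y z i = (Σ ℕ λ j → (j ≤ n) × (i ≡ suc j) × MeetBelow (x j) z y)
                             × (∀ j → j ≤ n → MeetBelow (x j) z y → suc j ≤ i)

Finite : Set → Set
Finite A = Σ ℕ λ m → A ↔ Fin m

StrictlyIncreasingOn : (n : ℕ) → (ℕ → ℤ) → Set
StrictlyIncreasingOn n l = ∀ i j → 1 ≤ i → i < j → j ≤ n → l i ℤ.< l j

{-# OPTIONS --safe #-}
-- For a cover y ⋖ z, the element (a ∨ y) ∧_y z lies in [y, z], so it is y or z, and it is z
-- exactly when a ∨ y ≥ z.  If a is left modular it also equals (a ∧ z) ∨^z y, which is y
-- exactly when a ∧ z ≤ y.  Along the chain x₀ ⋖ ⋯ ⋖ xₙ the first condition is upward closed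
-- and the second downward closed, so the index at which (x_j ∨ y) ∧_y z jumps from y to z is
-- both the least j with x_j ∨ y ≥ z and one more than the largest j with x_j ∧ z ≤ y.
module Submission where

open import Defs
open import Data.Nat using (ℕ; _≤_; _<_; _≤′_; suc; z≤n; s≤s; ≤′-refl; ≤′-step)
open import Data.Nat.Properties using (≤⇒≤′; <⇒≤; ≰⇒>; ≮⇒≥; <-cmp; 1+n≰n; suc-injective)
open import Data.Integer using (ℤ)
import Data.Integer.Properties as ℤ
open import Data.Product using (_×_; _,_; proj₁; proj₂; ∃)
open import Data.Sum using (_⊎_; inj₁; inj₂)
open import Data.Empty using (⊥-elim)
open import Relation.Nullary using (¬_)
open import Relation.Binary.Definitions using (tri<; tri≈; tri>)
open import Relation.Binary.PropositionalEquality using (_≡_; refl; sym; subst)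
open import Relation.Binary.Structures using (IsPartialOrder)
open import Function.Bundles using (_⇔_; mk⇔)

strictlyIncreasingOn-injective : ∀ {n l i j} → StrictlyIncreasingOn n l
  → 1 ≤ i → i ≤ n → 1 ≤ j → j ≤ n → l i ≡ l j → i ≡ j
strictlyIncreasingOn-injective {i = i} {j} inc 1≤i i≤n 1≤j j≤n li≡lj with <-cmp i j
... | tri< i<j _ _ = ⊥-elim (ℤ.<-irrefl li≡lj (inc i j 1≤i i<j j≤n))
... | tri≈ _ i≡j _ = i≡j
... | tri> _ _ j<i = ⊥-elim (ℤ.<-irrefl (sym li≡lj) (inc j i 1≤j j<i i≤n))

leftModular⇒rightExpr : ∀ {A : Set} {_⊑_ : A → A → Set} {a y z u} → LeftModular _⊑_ a
  → y ⊑ z → LeftExpr _⊑_ a y z u → RightExpr _⊑_ a y z u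
leftModular⇒rightExpr {_⊑_ = _⊑_} {a} {y} {z} {u} (viable , modular) y⊑z L
  with proj₂ (viable y z y⊑z)
... | v , R = subst (RightExpr _⊑_ a y z) (sym (modular y z u v y⊑z L R)) R

module Poset {A : Set} {_⊑_ : A → A → Set} (po : IsPartialOrder _≡_ _⊑_) where
  open IsPartialOrder po using (antisym) renaming (refl to ⊑-refl; trans to ⊑-trans)

  isJoin-monoˡ : ∀ {a b y j k} → a ⊑ b → IsJoin _⊑_ a y j → IsJoin _⊑_ b y k → j ⊑ k
  isJoin-monoˡ a⊑b (_ , _ , least) (b⊑k , y⊑k , _) = least _ (⊑-trans a⊑b b⊑k) y⊑k

  isMeet-monoˡ : ∀ {a b z m k} → a ⊑ b → IsMeet _⊑_ a z m → IsMeet _⊑_ b z k → m ⊑ k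
  isMeet-monoˡ a⊑b (m⊑a , m⊑z , _) (_ , _ , greatest) = greatest _ (⊑-trans m⊑a a⊑b) m⊑z

  module _ {y z : A} (cov : Covers _⊑_ y z) where
    private
      y⊑z : y ⊑ z
      y⊑z = proj₁ cov

      y≢z : ¬ y ≡ z
      y≢z = proj₁ (proj₂ cov)

    leftExpr-cases : ∀ {a u} → LeftExpr _⊑_ a y z u → u ≡ y ⊎ u ≡ z
    leftExpr-cases (_ , _ , y⊑u , _ , u⊑z , _) = proj₂ (proj₂ cov) _ y⊑u u⊑z

    leftExpr≡z⇒joinAbove : ∀ {a} → LeftExpr _⊑_ a y z z → JoinAbove _⊑_ a y z
    leftExpr≡z⇒joinAbove (j , isJoin , _ , z⊑j , _) = j , isJoin , z⊑j

    leftExpr≡y⇒¬joinAbove : ∀ {a b} → b ⊑ a → LeftExpr _⊑_ a y z y → ¬ JoinAbove _⊑_ b y z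
    leftExpr≡y⇒¬joinAbove b⊑a (_ , isJoinᵃ , _ , _ , _ , greatest) (_ , isJoinᵇ , z⊑jᵇ) =
      y≢z (antisym y⊑z (greatest z y⊑z (⊑-trans z⊑jᵇ (isJoin-monoˡ b⊑a isJoinᵇ isJoinᵃ)) ⊑-refl))

    rightExpr≡y⇒meetBelow : ∀ {a} → RightExpr _⊑_ a y z y → MeetBelow _⊑_ a z y
    rightExpr≡y⇒meetBelow (m , isMeet , m⊑y , _) = m , isMeet , m⊑y

    rightExpr≡z⇒¬meetBelow : ∀ {a b} → a ⊑ b → RightExpr _⊑_ a y z z → ¬ MeetBelow _⊑_ b z y
    rightExpr≡z⇒¬meetBelow a⊑b (_ , isMeetᵃ , _ , _ , _ , least) (_ , isMeetᵇ , mᵇ⊑y) =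
      y≢z (antisym y⊑z (least y (⊑-trans (isMeet-monoˡ a⊑b isMeetᵃ isMeetᵇ) mᵇ⊑y) ⊑-refl y⊑z))

    joinAbove⇒leftExpr≡z : ∀ {a} → ∃ (LeftExpr _⊑_ a y z) → JoinAbove _⊑_ a y z
      → LeftExpr _⊑_ a y z z
    joinAbove⇒leftExpr≡z (u , L) up with leftExpr-cases L
    ... | inj₁ refl = ⊥-elim (leftExpr≡y⇒¬joinAbove ⊑-refl L up)
    ... | inj₂ refl = L

    ¬joinAbove⇒leftExpr≡y : ∀ {a} → ∃ (LeftExpr _⊑_ a y z) → ¬ JoinAbove _⊑_ a y z
      → LeftExpr _⊑_ a y z y
    ¬joinAbove⇒leftExpr≡y (u , L) ¬up with leftExpr-cases L
    ... | inj₁ refl = L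
    ... | inj₂ refl = ⊥-elim (¬up (leftExpr≡z⇒joinAbove L))

  module Chain {n : ℕ} {x : ℕ → A} (covs : ∀ k → k < n → Covers _⊑_ (x k) (x (suc k)))
    where

    chain-mono : ∀ {j k} → j ≤ k → k ≤ n → x j ⊑ x k
    chain-mono j≤k = go (≤⇒≤′ j≤k)
      where
      go : ∀ {j k} → j ≤′ k → k ≤ n → x j ⊑ x k
      go ≤′-refl _ = ⊑-refl
      go (≤′-step {k} j≤′k) k<n = ⊑-trans (go j≤′k (<⇒≤ k<n)) (proj₁ (covs k k<n))

    module Edge (leftModular : ∀ k → k ≤ n → LeftModular _⊑_ (x k))
             {y z : A} (cov : Covers _⊑_ y z) where

      JumpsAt : ℕ → Set
      JumpsAt k = LeftExpr _⊑_ (x k) y z y × LeftExpr _⊑_ (x (suc k)) y z z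

      label⇒jumpsAt : ∀ {l k} → StrictlyIncreasingOn n l → suc k ≤ n
        → Label _⊑_ n x l y z (l (suc k)) → JumpsAt k
      label⇒jumpsAt inc sk≤n (k′ , sk′≤n , eq , jump)
        with refl ← suc-injective
                      (strictlyIncreasingOn-injective inc (s≤s z≤n) sk≤n (s≤s z≤n) sk′≤n eq)
        = jump

      jumpsAt⇒isMinJoinAbove : ∀ {k} → suc k ≤ n → JumpsAt k → IsMinJoinAbove _⊑_ n x y z (suc k)
      jumpsAt⇒isMinJoinAbove {k} sk≤n (below , above) =
        sk≤n , leftExpr≡z⇒joinAbove cov above , least
        where
        least : ∀ j → j ≤ n → JoinAbove _⊑_ (x j) y z → suc k ≤ j
        least j _ up = ≰⇒> λ j≤k → leftExpr≡y⇒¬joinAbove cov (chain-mono j≤k (<⇒≤ sk≤n)) below up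

      jumpsAt⇒isMaxMeetBelow : ∀ {k} → suc k ≤ n → JumpsAt k → IsMaxMeetBelow _⊑_ n x y z (suc k)
      jumpsAt⇒isMaxMeetBelow {k} sk≤n (below , above) =
        (k , k≤n , refl , rightExpr≡y⇒meetBelow cov (toRight k≤n below)) , greatest
        where
        k≤n : k ≤ n
        k≤n = <⇒≤ sk≤n
        toRight : ∀ {j u} → j ≤ n → LeftExpr _⊑_ (x j) y z u → RightExpr _⊑_ (x j) y z u
        toRight j≤n = leftModular⇒rightExpr (leftModular _ j≤n) (proj₁ cov)
        greatest : ∀ j → j ≤ n → MeetBelow _⊑_ (x j) z y → suc j ≤ suc k
        greatest j j≤n down = s≤s (≮⇒≥ λ k<j →
          rightExpr≡z⇒¬meetBelow cov (chain-mono k<j j≤n) (toRight sk≤n above) down)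

      isMinJoinAbove⇒jumpsAt : ∀ {k} → IsMinJoinAbove _⊑_ n x y z (suc k) → JumpsAt k
      isMinJoinAbove⇒jumpsAt {k} (sk≤n , up , least) =
        ¬joinAbove⇒leftExpr≡y cov (leftExprExists k≤n) (λ upₖ → 1+n≰n (least k k≤n upₖ)) ,
        joinAbove⇒leftExpr≡z cov (leftExprExists sk≤n) up
        where
        k≤n : k ≤ n
        k≤n = <⇒≤ sk≤n
        leftExprExists : ∀ {j} → j ≤ n → ∃ (LeftExpr _⊑_ (x j) y z)
        leftExprExists j≤n = proj₁ (proj₁ (leftModular _ j≤n) y z (proj₁ cov))

lemma1 : {A : Set} (_⊑_ : A → A → Set) → IsPartialOrder _≡_ _⊑_ → Finite A
    → (bot top : A) → (∀ a → bot ⊑ a) → (∀ a → a ⊑ top)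
    → (n : ℕ) (x : ℕ → A) → IsLeftModularMaximalChain _⊑_ bot top n x
    → (l : ℕ → ℤ) → StrictlyIncreasingOn n l
    → ∀ y z → Covers _⊑_ y z → ∀ i → 1 ≤ i → i ≤ n
    → Label _⊑_ n x l y z (l i)
    ⇔ (IsMinJoinAbove _⊑_ n x y z i × IsMaxMeetBelow _⊑_ n x y z i)
lemma1 _⊑_ po _ _ _ _ _ n x (_ , _ , covs , leftModular) l inc y z cov (suc k) (s≤s z≤n) sk≤n =
  mk⇔ (λ label → let jump = label⇒jumpsAt inc sk≤n label in
                   jumpsAt⇒isMinJoinAbove sk≤n jump , jumpsAt⇒isMaxMeetBelow sk≤n jump)
      (λ (isMin , _) → k , sk≤n , refl , isMinJoinAbove⇒jumpsAt isMin)
  where open Poset.Chain.Edge po covs leftModular cov
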